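{- Let $G$ be a connected graph such that $\overline{G}$ is connected. Then $\mathrm{m}(G\overline{G})=3$ if $G = C_5$, and $\mathrm{m}(G\overline{G})=2$ otherwise.
   Context: All graphs are finite, simple and undirected; $C_5$ is the cycle on $5$ vertices. The complementary prism $G\overline{G}$ of a graph $G$ is obtained from the disjoint union of $G$ and its complement $\overline{G}$ by adding the edges of the perfect matching joining each vertex $u$ of $G$ to its copy $\overline{u}$ in $\overline{G}$. A path is monophonic if it is an induced (chordless) path. For vertices $u,v$ of a graph $H$, $J_H[u,v]$ is the set of vertices of all monophonic $u,v$-paths in $H$, and for $S\subseteq V(H)$, $J_H[S]=\bigcup_{u,v\in S}J_H[u,v]$. A set $S$ is a monophonic set of $H$ if $J_H[S]=V(H)$; the monophonic number $\mathrm{m}(H)$ is the minimum cardinality of a monophonic set of $H$. -}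

module Defs where

open import Data.Nat using (ℕ; zero; suc; _≤_; _<_; ∣_-_∣; _≟_)
open import Data.Nat.Properties using (∣-∣-comm; ∣n-n∣≡0)
open import Data.Fin using (Fin; toℕ)
import Data.Fin as F
open import Data.Sum using (_⊎_; inj₁; inj₂)
open import Data.Product using (Σ; ∃; _×_; _,_)
open import Data.List using (List; length; head; last; lookup)
open import Data.List.Membership.Propositional using (_∈_)
open import Data.List.Relation.Unary.Unique.Propositional using (Unique)
open import Data.List.Relation.Unary.Linked using (Linked)
open import Data.Maybe using (just)
open import Relation.Nullary using (¬_; Dec; yes; no)
open import Relation.Nullary.Decidable using (_×-dec_; ¬?; _⊎-dec_)
open import Relation.Binary.PropositionalEquality using (_≡_; _≢_; refl; sym; trans; subst)
open import Relation.Binary.Construct.Closure.ReflexiveTransitive using (Star)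
open import Function.Bundles using (_↔_; Inverse; _⇔_)
open import Data.Empty using (⊥)

record Graph (n : ℕ) : Set₁ where
  field
    Adj    : Fin n → Fin n → Set
    symm   : ∀ {u v} → Adj u v → Adj v u
    irrefl : ∀ {u} → ¬ Adj u u
    dec    : ∀ u v → Dec (Adj u v)
open Graph public

complement : ∀ {n} → Graph n → Graph n
complement G = record
  { Adj    = λ u v → (u ≢ v) × ¬ Adj G u v
  ; symm   = λ { (u≢v , ¬a) → (λ e → u≢v (sym e)) , (λ a → ¬a (symm G a)) }
  ; irrefl = λ { (u≢u , _) → u≢u refl }
  ; dec    = λ u v → ¬? (u F.≟ v) ×-dec ¬? (dec G u v)
  }

Connected : ∀ {n} → Graph n → Set
Connected {n} G = ∀ (u v : Fin n) → Star (Adj G) u v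

C5 : Graph 5
C5 = record
  { Adj    = λ u v → (∣ toℕ u - toℕ v ∣ ≡ 1) ⊎ (∣ toℕ u - toℕ v ∣ ≡ 4)
  ; symm   = λ {u} {v} → λ
      { (inj₁ e) → inj₁ (trans (∣-∣-comm (toℕ v) (toℕ u)) e)
      ; (inj₂ e) → inj₂ (trans (∣-∣-comm (toℕ v) (toℕ u)) e) }
  ; irrefl = λ {u} → λ
      { (inj₁ e) → z≢s (trans (sym (∣n-n∣≡0 (toℕ u))) e)
      ; (inj₂ e) → z≢s (trans (sym (∣n-n∣≡0 (toℕ u))) e) }
  ; dec    = λ u v → (∣ toℕ u - toℕ v ∣ ≟ 1) ⊎-dec (∣ toℕ u - toℕ v ∣ ≟ 4)
  }
  where
  z≢s : ∀ {m} → ¬ (0 ≡ suc m)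
  z≢s ()

Isomorphic : ∀ {n m} → Graph n → Graph m → Set
Isomorphic {n} {m} G H =
  Σ (Fin n ↔ Fin m) λ f →
    ∀ u v → Adj G u v ⇔ Adj H (Inverse.to f u) (Inverse.to f v)

-- Complementary prism G Ḡ: vertices inj₁ u (copy in G) and inj₂ u (copy in Ḡ)

PrismAdj : ∀ {n} → Graph n → (Fin n ⊎ Fin n) → (Fin n ⊎ Fin n) → Set
PrismAdj G (inj₁ u) (inj₁ v) = Adj G u v
PrismAdj G (inj₂ u) (inj₂ v) = Adj (complement G) u v
PrismAdj G (inj₁ u) (inj₂ v) = u ≡ v
PrismAdj G (inj₂ u) (inj₁ v) = u ≡ v

module _ {V : Set} (R : V → V → Set) where

  -- a monophonic (induced) path, given as the list of its vertices in order
  IsMonophonicPath : List V → Set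
  IsMonophonicPath p =
    Linked R p × Unique p ×
    (∀ (i j : Fin (length p)) → suc (toℕ i) < toℕ j → ¬ R (lookup p i) (lookup p j))

  InInterval : V → V → V → Set
  InInterval u v x = ∃ λ (p : List V) →
    IsMonophonicPath p × head p ≡ just u × last p ≡ just v × x ∈ p

  IsMonophonicSet : List V → Set
  IsMonophonicSet S = ∀ (x : V) → ∃ λ u → ∃ λ v → u ∈ S × v ∈ S × InInterval u v x

  MonophonicNumberIs : ℕ → Set
  MonophonicNumberIs k =
    (∃ λ (S : List V) → Unique S × length S ≡ k × IsMonophonicSet S) ×
    (∀ (S : List V) → Unique S → IsMonophonicSet S → k ≤ length S)

{-# OPTIONS --safe #-}
-- The prism of Ḡ is the prism of G with its two copies swapped, so every construction may be run on G
-- or on Ḡ. A single vertex a is never monophonic, as J[a,a] = {a}; the question is when two vertices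
-- suffice.
--
-- If u and v are at distance at least 3, then {u, v} is monophonic: an induced u–x path, cut after its
-- last vertex in N[v], continues as x x̄ v̄ v or, read from v, as x x̄ ū u.
--
-- Otherwise G and Ḡ both have diameter 2. Call an edge uv good if every neighbour x of v outside N[u]
-- has a common neighbour with u other than v; then {u, v̄} is monophonic, using paths u … x x̄ (z̄) v̄.
-- If no edge of G or of Ḡ is good, the witnesses of badness close up into a 5-cycle u v x z y through
-- every vertex, so G ≅ C₅. The prism of C₅ is the Petersen graph, whose induced paths have at most five
-- vertices; enumerating them shows that no pair of its vertices is monophonic, while the copies in G of
-- the vertices 0, 1, 3 of C₅ are.
module Submission where

open import Defs
open import Data.Empty using (⊥; ⊥-elim)
open import Data.Fin as F using (Fin; toℕ)
open import Data.Fin.Patterns using (0F; 1F; 2F; 3F; 4F)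
open import Data.Fin.Properties using (any?; all?; ¬∀⟶∃¬)
open import Data.List using (List; []; _∷_; length; head; last; lookup; map; _++_; concatMap; allFin)
open import Data.List.Properties using (head-map; last-map; length-map)
open import Data.List.Membership.Propositional using (_∈_; _∉_; find; lose)
open import Data.List.Membership.Propositional.Properties
  using (∈-++⁻; ∈-++⁺ˡ; ∈-++⁺ʳ; ∈-map⁺; ∈-map⁻; ∈-lookup; ∈-allFin)
import Data.List.Membership.DecPropositional as DecMembership
open import Data.List.Relation.Unary.All as All using (All; []; _∷_)
open import Data.List.Relation.Unary.All.Properties using (¬Any⇒All¬; All¬⇒¬Any; ++⁺)
open import Data.List.Relation.Unary.Any as Any using (Any; here; there; index)
open import Data.List.Relation.Unary.Any.Properties as Anyₚ using (lookup-index; ¬Any[])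
open import Data.List.Relation.Unary.Linked as Linked using ([]; _∷_)
open import Data.List.Relation.Unary.Unique.Propositional using (Unique; []; _∷_)
import Data.List.Relation.Unary.Unique.Propositional.Properties as Uniqueₚ
open import Data.Maybe as Maybe using (just)
import Data.Maybe.Properties as Maybeₚ
open import Data.Nat using (ℕ; zero; suc; _+_; _≤_; _<_; _≤?_; z≤n; s≤s)
open import Data.Nat.Properties using (≤-trans; ≤-reflexive; ≤-pred; m≤n⇒m<n∨m≡n; ≰⇒>)
open import Data.Product using (Σ; ∃; ∃₂; _×_; _,_; proj₁; proj₂)
open import Data.Sum as Sum using (_⊎_; inj₁; inj₂)
import Data.Sum.Properties as Sumₚ
open import Function using (_∘_)
open import Function.Bundles using (Inverse; Equivalence; _⇔_; mk⇔; mk↔ₛ′)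
import Function.Properties.Equivalence as ⇔
open import Relation.Binary.Construct.Closure.ReflexiveTransitive using (Star; ε; _◅_)
open import Relation.Binary.Definitions using (DecidableEquality)
open import Relation.Binary.PropositionalEquality
  using (_≡_; _≢_; ≢-sym; refl; sym; trans; cong; subst; subst₂)
open import Relation.Nullary using (¬_; Dec; yes; no)
open import Relation.Nullary.Decidable using (_⊎-dec_; _×-dec_; _→-dec_; ¬?; toWitness; decidable-stable)

last∈ : ∀ {A : Set} {xs : List A} {y} → last xs ≡ just y → y ∈ xs
last∈ {xs = _ ∷ []} refl = here refl
last∈ {xs = _ ∷ x ∷ xs} e = there (last∈ {xs = x ∷ xs} e)

last-++ : ∀ {A : Set} (xs : List A) y ys → last (xs ++ y ∷ ys) ≡ last (y ∷ ys)
last-++ [] y ys = refl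
last-++ (_ ∷ []) y ys = refl
last-++ (_ ∷ x ∷ xs) y ys = last-++ (x ∷ xs) y ys

module _ {A : Set} {P : A → Set} (P? : ∀ a → Dec (P a)) where

  SplitAtLast : List A → Set
  SplitAtLast xs = ∃₂ λ pre c → ∃ λ suf → xs ≡ pre ++ c ∷ suf × P c × All (λ a → ¬ P a) suf

  splitAtLast : ∀ xs → All (λ a → ¬ P a) xs ⊎ SplitAtLast xs
  splitAtLast [] = inj₁ []
  splitAtLast (x ∷ xs) with splitAtLast xs
  ... | inj₂ (pre , c , suf , refl , pc , ¬P) = inj₂ (x ∷ pre , c , suf , refl , pc , ¬P)
  ... | inj₁ ¬P with P? x
  ...   | yes px = inj₂ ([] , x , xs , refl , px , ¬P)
  ...   | no ¬px = inj₁ (¬px ∷ ¬P)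

module InducedPath {V : Set} (R : V → V → Set) where

  data Induced : List V → Set where
    []   : Induced []
    [-]  : ∀ {a} → Induced (a ∷ [])
    cons : ∀ {a b p} → R a b → a ∉ b ∷ p → All (λ c → ¬ R a c) p →
           Induced (b ∷ p) → Induced (a ∷ b ∷ p)

  induced⇒monophonic : ∀ {p} → Induced p → IsMonophonicPath R p
  induced⇒monophonic [] = [] , [] , λ ()
  induced⇒monophonic [-] = Linked.[-] , [] ∷ [] , λ { F.zero F.zero () ; F.zero (F.suc ()) ; (F.suc ()) }
  induced⇒monophonic {a ∷ b ∷ p} (cons r a∉ ¬r ip) with induced⇒monophonic ip
  ... | linked , unique , chordless = r ∷ linked , ¬Any⇒All¬ _ a∉ ∷ unique , chordless′
    where
    chordless′ : ∀ (i j : Fin (2 + length p)) → suc (toℕ i) < toℕ j →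
                 ¬ R (lookup (a ∷ b ∷ p) i) (lookup (a ∷ b ∷ p) j)
    chordless′ F.zero (F.suc F.zero) (s≤s ())
    chordless′ F.zero (F.suc (F.suc j)) _ = All.lookup ¬r (∈-lookup j)
    chordless′ (F.suc i) (F.suc j) (s≤s i+1<j) = chordless i j i+1<j

  monophonic⇒induced : ∀ p → IsMonophonicPath R p → Induced p
  monophonic⇒induced [] _ = []
  monophonic⇒induced (a ∷ []) _ = [-]
  monophonic⇒induced (a ∷ b ∷ p) (r ∷ linked , a∉ ∷ unique , chordless) =
    cons r (All¬⇒¬Any a∉) (All.tabulate ¬chord)
      (monophonic⇒induced (b ∷ p)
        (linked , unique , λ i j i+1<j → chordless (F.suc i) (F.suc j) (s≤s i+1<j)))
    where
    ¬chord : ∀ {c} → c ∈ p → ¬ R a c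
    ¬chord c∈p rewrite lookup-index c∈p =
      chordless F.zero (F.suc (F.suc (index c∈p))) (s≤s (s≤s z≤n))

  induced-tail : ∀ {a p} → Induced (a ∷ p) → Induced p
  induced-tail [-] = []
  induced-tail (cons _ _ _ ip) = ip

  induced-head∉ : ∀ {a p} → Induced (a ∷ p) → a ∉ p
  induced-head∉ [-] ()
  induced-head∉ (cons _ a∉ _ _) = a∉

  induced-drop : ∀ pre {q} → Induced (pre ++ q) → Induced q
  induced-drop [] ip = ip
  induced-drop (_ ∷ pre) ip = induced-drop pre (induced-tail ip)

  induced-++ : ∀ {p y z q} → Induced p → last p ≡ just y → Induced (z ∷ q) → R y z →
               (∀ {a b} → a ∈ p → b ∈ z ∷ q → a ≢ b) →
               (∀ {a b} → a ∈ p → b ∈ z ∷ q → R a b → a ≡ y × b ≡ z) →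
               Induced (p ++ z ∷ q)
  induced-++ {q = q} [-] refl iq ryz disjoint onlyEdge =
    cons ryz (λ a∈ → disjoint (here refl) a∈ refl)
      (All.tabulate λ b∈q r →
        induced-head∉ iq (subst (_∈ q) (proj₂ (onlyEdge (here refl) (there b∈q) r)) b∈q)) iq
  induced-++ {z = z} {q} (cons {a} {b} {p} r a∉ ¬r ip) lp iq ryz disjoint onlyEdge =
    cons r a∉′ (++⁺ ¬r (All.tabulate ¬r′))
      (induced-++ ip lp iq ryz (λ a∈ → disjoint (there a∈)) (λ a∈ → onlyEdge (there a∈)))
    where
    a∉′ : a ∉ b ∷ (p ++ z ∷ q)
    a∉′ a∈ with ∈-++⁻ (b ∷ p) a∈
    ... | inj₁ a∈p = a∉ a∈p
    ... | inj₂ a∈q = disjoint (here refl) a∈q refl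
    ¬r′ : ∀ {c} → c ∈ z ∷ q → ¬ R a c
    ¬r′ c∈ rac =
      a∉ (subst (_∈ b ∷ p) (sym (proj₁ (onlyEdge (here refl) c∈ rac))) (last∈ {xs = b ∷ p} lp))

  induced⇒interval : ∀ {p u v x} → Induced p → head p ≡ just u → last p ≡ just v → x ∈ p →
                     InInterval R u v x
  induced⇒interval {p} ip hp lp x∈ = p , induced⇒monophonic ip , hp , lp , x∈

module Shortcut {V : Set} (R : V → V → Set) (irreflexive : ∀ {a} → ¬ R a a)
                (R? : ∀ a b → Dec (R a b)) (_≟_ : DecidableEquality V) where
  open InducedPath R

  walk⇒induced : ∀ {u x} → Star R u x → ∃ λ Q → Induced Q × head Q ≡ just u × last Q ≡ just x
  walk⇒induced {u} ε = u ∷ [] , [-] , refl , refl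
  walk⇒induced {u} {x} (_◅_ {j = w} ruw rest) with walk⇒induced rest
  ... | Q , iQ , hQ , lQ with splitAtLast (λ c → (u ≟ c) ⊎-dec R? u c) Q
  ...   | inj₁ ¬N = ⊥-elim (unreached Q hQ ¬N)
    where
    unreached : ∀ Q → head Q ≡ just w → ¬ All (λ c → ¬ (u ≡ c ⊎ R u c)) Q
    unreached (c ∷ Q) refl (¬N ∷ _) = ¬N (inj₂ ruw)
  ...   | inj₂ (pre , c , suf , refl , inj₁ refl , _) =
          c ∷ suf , induced-drop pre iQ , refl , trans (sym (last-++ pre c suf)) lQ
  ...   | inj₂ (pre , c , suf , refl , inj₂ ruc , ¬N) =
          u ∷ c ∷ suf , cons ruc u∉ (All.map (λ ¬n r → ¬n (inj₂ r)) ¬N) (induced-drop pre iQ) , refl ,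
          trans (sym (last-++ pre c suf)) lQ
    where
    u∉ : u ∉ c ∷ suf
    u∉ (here refl) = irreflexive ruc
    u∉ (there u∈) = All.lookup ¬N u∈ (inj₁ refl)

record _≅_ {V W : Set} (R : V → V → Set) (R′ : W → W → Set) : Set where
  field
    to       : V → W
    from     : W → V
    from∘to  : ∀ a → from (to a) ≡ a
    to∘from  : ∀ c → to (from c) ≡ c
    to-adj   : ∀ {a b} → R a b → R′ (to a) (to b)
    from-adj : ∀ {c d} → R′ c d → R (from c) (from d)

  to-injective : ∀ {a b} → to a ≡ to b → a ≡ b
  to-injective {a} {b} e = trans (sym (from∘to a)) (trans (cong from e) (from∘to b))

  to-reflects-adj : ∀ {a b} → R′ (to a) (to b) → R a b
  to-reflects-adj {a} {b} r = subst₂ R (from∘to a) (from∘to b) (from-adj r)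

≅-sym : ∀ {V W : Set} {R : V → V → Set} {R′ : W → W → Set} → R ≅ R′ → R′ ≅ R
≅-sym iso = record
  { to = from ; from = to ; from∘to = to∘from ; to∘from = from∘to ; to-adj = from-adj ; from-adj = to-adj }
  where open _≅_ iso

record InducedEmbedding {V W : Set} (R : V → V → Set) (R′ : W → W → Set) : Set where
  field
    embed     : V → W
    injective : ∀ {a b} → embed a ≡ embed b → a ≡ b
    preserves : ∀ {a b} → R a b → R′ (embed a) (embed b)
    reflects  : ∀ {a b} → R′ (embed a) (embed b) → R a b

  map-induced : ∀ {p} → InducedPath.Induced R p → InducedPath.Induced R′ (map embed p)
  map-induced InducedPath.[] = InducedPath.[]
  map-induced InducedPath.[-] = InducedPath.[-]
  map-induced {a ∷ b ∷ p} (InducedPath.cons r a∉ ¬r ip) =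
    InducedPath.cons (preserves r) embed-a∉ (All.tabulate ¬r′) (map-induced ip)
    where
    embed-a∉ : embed a ∉ map embed (b ∷ p)
    embed-a∉ m with ∈-map⁻ embed m
    ... | c , c∈ , e = a∉ (subst (_∈ b ∷ p) (sym (injective e)) c∈)
    ¬r′ : ∀ {d} → d ∈ map embed p → ¬ R′ (embed a) d
    ¬r′ d∈ r′ with ∈-map⁻ embed d∈
    ... | c , c∈ , refl = All.lookup ¬r c∈ (reflects r′)

≅⇒embedding : ∀ {V W : Set} {R : V → V → Set} {R′ : W → W → Set} →
              R ≅ R′ → InducedEmbedding R R′
≅⇒embedding iso = record
  { embed = to ; injective = to-injective ; preserves = to-adj ; reflects = to-reflects-adj }
  where open _≅_ iso

module _ {V W : Set} {R : V → V → Set} {R′ : W → W → Set} (iso : R ≅ R′) where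
  open _≅_ iso
  open InducedPath
  open InducedEmbedding (≅⇒embedding iso) using (map-induced)

  map-monophonicSet : ∀ {S} → IsMonophonicSet R S → IsMonophonicSet R′ (map to S)
  map-monophonicSet monoS y with monoS (from y)
  ... | u , v , u∈ , v∈ , p , mp , hp , lp , y∈ =
    to u , to v , ∈-map⁺ to u∈ , ∈-map⁺ to v∈ ,
    induced⇒interval R′ (map-induced (monophonic⇒induced R p mp))
      (trans (head-map {f = to} p) (cong (Maybe.map to) hp))
      (trans (last-map to p) (cong (Maybe.map to) lp))
      (subst (_∈ map to p) (to∘from y) (∈-map⁺ to y∈))

monophonicNumber-≅ : ∀ {V W : Set} {R : V → V → Set} {R′ : W → W → Set} {k} →
                     R ≅ R′ → MonophonicNumberIs R k → MonophonicNumberIs R′ k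
monophonicNumber-≅ iso ((S , uniqueS , |S|≡k , monoS) , minimal) =
  (map to S , Uniqueₚ.map⁺ to-injective uniqueS , trans (length-map to S) |S|≡k ,
   map-monophonicSet iso monoS) ,
  λ S′ uniqueS′ monoS′ →
    ≤-trans (minimal (map from S′) (Uniqueₚ.map⁺ (_≅_.to-injective (≅-sym iso)) uniqueS′)
                     (map-monophonicSet (≅-sym iso) monoS′))
            (≤-reflexive (length-map from S′))
  where open _≅_ iso

module _ {V : Set} (R : V → V → Set) where

  interval-self : ∀ {u x} → InInterval R u u x → x ≡ u
  interval-self (_ ∷ [] , _ , refl , _ , here x≡u) = x≡u
  interval-self (_ ∷ b ∷ p , (_ , u∉ ∷ _ , _) , refl , lp , _) =
    ⊥-elim (All¬⇒¬Any u∉ (last∈ {xs = b ∷ p} lp))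

  two≤monophonicSet : ∀ {x₁ x₂} → x₁ ≢ x₂ → ∀ S → IsMonophonicSet R S → 2 ≤ length S
  two≤monophonicSet _ (_ ∷ _ ∷ _) _ = s≤s (s≤s z≤n)
  two≤monophonicSet {x₁} {x₂} x₁≢x₂ [] monoS with monoS x₁
  ... | _ , _ , () , _
  two≤monophonicSet {x₁} {x₂} x₁≢x₂ (a ∷ []) monoS with monoS x₁ | monoS x₂
  ... | _ , _ , here refl , here refl , J₁ | _ , _ , here refl , here refl , J₂ =
    ⊥-elim (x₁≢x₂ (trans (interval-self J₁) (sym (interval-self J₂))))

  monophonicNumber≡2 : ∀ {x₁ x₂ a b} → x₁ ≢ x₂ → a ≢ b →
                       IsMonophonicSet R (a ∷ b ∷ []) → MonophonicNumberIs R 2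
  monophonicNumber≡2 x₁≢x₂ a≢b monoS =
    (_ , (¬Any⇒All¬ _ (λ { (here a≡b) → a≢b a≡b ; (there ()) }) ∷ [] ∷ []) , refl , monoS) ,
    λ S _ → two≤monophonicSet x₁≢x₂ S

module _ {m : ℕ} (K : Graph m) where
  open InducedPath (Adj K)

  adj⇒≢ : ∀ {a b} → Adj K a b → a ≢ b
  adj⇒≢ ab refl = irrefl K ab

  edge-induced : ∀ {a b} → Adj K a b → Induced (a ∷ b ∷ [])
  edge-induced ab = cons ab (λ { (here refl) → irrefl K ab }) [] [-]

  twoEdges-induced : ∀ {a b c} → Adj K a b → Adj K b c → ¬ Adj K a c → a ≢ c →
                     Induced (a ∷ b ∷ c ∷ [])
  twoEdges-induced ab bc ¬ac a≢c =
    cons ab (λ { (here refl) → irrefl K ab ; (there (here refl)) → a≢c refl }) (¬ac ∷ [])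
      (edge-induced bc)

swap : ∀ {m} → Fin m ⊎ Fin m → Fin m ⊎ Fin m
swap (inj₁ a) = inj₂ a
swap (inj₂ a) = inj₁ a

swap-involutive : ∀ {m} (a : Fin m ⊎ Fin m) → swap (swap a) ≡ a
swap-involutive (inj₁ a) = refl
swap-involutive (inj₂ a) = refl

prism-complement : ∀ {m} (G : Graph m) → PrismAdj G ≅ PrismAdj (complement G)
prism-complement G = record
  { to = swap ; from = swap ; from∘to = swap-involutive ; to∘from = swap-involutive
  ; to-adj = λ {a} {b} → to-adj a b ; from-adj = λ {a} {b} → from-adj a b }
  where
  to-adj : ∀ a b → PrismAdj G a b → PrismAdj (complement G) (swap a) (swap b)
  to-adj (inj₁ a) (inj₁ b) r = adj⇒≢ G r , (λ ¬r → proj₂ ¬r r)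
  to-adj (inj₁ a) (inj₂ b) r = r
  to-adj (inj₂ a) (inj₁ b) r = r
  to-adj (inj₂ a) (inj₂ b) r = r
  from-adj : ∀ a b → PrismAdj (complement G) a b → PrismAdj G (swap a) (swap b)
  from-adj (inj₁ a) (inj₁ b) r = r
  from-adj (inj₁ a) (inj₂ b) r = r
  from-adj (inj₂ a) (inj₁ b) r = r
  from-adj (inj₂ a) (inj₂ b) (a≢b , ¬¬r) with dec G a b
  ... | yes r = r
  ... | no ¬r = ⊥-elim (¬¬r (a≢b , ¬r))

isomorphic⇒≅ : ∀ {m n} (G : Graph m) (H : Graph n) → Isomorphic G H → Adj G ≅ Adj H
isomorphic⇒≅ G H (f , adj) = record
  { to = to ; from = from ; from∘to = strictlyInverseʳ ; to∘from = strictlyInverseˡ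
  ; to-adj = λ {a} {b} → Equivalence.to (adj a b) ; from-adj = λ {c} {d} → from-adj c d }
  where
  open Inverse f
  from-adj : ∀ c d → Adj H c d → Adj G (from c) (from d)
  from-adj c d r = Equivalence.from (adj (from c) (from d))
                     (subst₂ (Adj H) (sym (strictlyInverseˡ c)) (sym (strictlyInverseˡ d)) r)

prism-adj : ∀ {m n} {G : Graph m} {H : Graph n} (iso : Adj G ≅ Adj H) →
            let f = Sum.map (_≅_.to iso) (_≅_.to iso) in ∀ a b → PrismAdj G a b → PrismAdj H (f a) (f b)
prism-adj iso (inj₁ a) (inj₁ b) r = _≅_.to-adj iso r
prism-adj iso (inj₁ a) (inj₂ b) refl = refl
prism-adj iso (inj₂ a) (inj₁ b) refl = refl
prism-adj iso (inj₂ a) (inj₂ b) (a≢b , ¬ab) =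
  a≢b ∘ _≅_.to-injective iso , ¬ab ∘ _≅_.to-reflects-adj iso

prism-≅ : ∀ {m n} (G : Graph m) (H : Graph n) → Adj G ≅ Adj H → PrismAdj G ≅ PrismAdj H
prism-≅ G H iso = record
  { to = Sum.map to to ; from = Sum.map from from
  ; from∘to = λ { (inj₁ a) → cong inj₁ (from∘to a) ; (inj₂ a) → cong inj₂ (from∘to a) }
  ; to∘from = λ { (inj₁ c) → cong inj₁ (to∘from c) ; (inj₂ c) → cong inj₂ (to∘from c) }
  ; to-adj = λ {a} {b} → prism-adj iso a b ; from-adj = λ {c} {d} → prism-adj (≅-sym iso) c d }
  where open _≅_ iso

ClosedNbhd : ∀ {m} → Graph m → Fin m → Fin m → Set
ClosedNbhd H b t = b ≡ t ⊎ Adj H b t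

module Prism {m : ℕ} (H : Graph m) where
  open InducedPath

  P : Fin m ⊎ Fin m → Fin m ⊎ Fin m → Set
  P = PrismAdj H

  ι₁-embedding : InducedEmbedding (Adj H) P
  ι₁-embedding = record
    { embed = inj₁ ; injective = λ { refl → refl } ; preserves = λ r → r ; reflects = λ r → r }
  open InducedEmbedding ι₁-embedding using (map-induced)

  ι₂-embedding : InducedEmbedding (Adj (complement H)) P
  ι₂-embedding = record
    { embed = inj₂ ; injective = λ { refl → refl } ; preserves = λ r → r ; reflects = λ r → r }

  ThroughBoth : Fin m ⊎ Fin m → Fin m ⊎ Fin m → Fin m → Set
  ThroughBoth s t x =
    ∃ λ p → Induced P p × head p ≡ just s × last p ≡ just t × inj₁ x ∈ p × inj₂ x ∈ p

  Covers : List (Fin m ⊎ Fin m) → Fin m → Set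
  Covers S x = ∃₂ λ s t → s ∈ S × t ∈ S × ThroughBoth s t x

  covers⇒monophonicSet : ∀ {S} → (∀ x → Covers S x) → IsMonophonicSet P S
  covers⇒monophonicSet covers (inj₁ x) with covers x
  ... | s , t , s∈ , t∈ , p , ip , hp , lp , x₁∈ , _ =
    s , t , s∈ , t∈ , induced⇒interval P ip hp lp x₁∈
  covers⇒monophonicSet covers (inj₂ x) with covers x
  ... | s , t , s∈ , t∈ , p , ip , hp , lp , _ , x₂∈ =
    s , t , s∈ , t∈ , induced⇒interval P ip hp lp x₂∈

  crossing : ∀ T′ {s x t} U → head (T′ ++ x ∷ []) ≡ just s → last (x ∷ U) ≡ just t →
             Induced (Adj H) (T′ ++ x ∷ []) → Induced (Adj (complement H)) (x ∷ U) →
             All (λ a → All (a ≢_) (x ∷ U)) T′ → ThroughBoth (inj₁ s) (inj₂ t) x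
  crossing T′ {s} {x} U hT lU iT iU separated =
    map inj₁ T ++ map inj₂ (x ∷ U) ,
    induced-++ P (map-induced iT) (trans (last-map inj₁ T) (cong (Maybe.map inj₁) (last-++ T′ x [])))
      (InducedEmbedding.map-induced ι₂-embedding iU) refl disjoint onlyEdge ,
    head-crossing T′ hT ,
    trans (last-++ (map inj₁ T) (inj₂ x) (map inj₂ U))
          (trans (last-map inj₂ (x ∷ U)) (cong (Maybe.map inj₂) lU)) ,
    ∈-++⁺ˡ (∈-map⁺ inj₁ (∈-++⁺ʳ T′ (here refl))) , ∈-++⁺ʳ (map inj₁ T) (here refl)
    where
    T : List (Fin m)
    T = T′ ++ x ∷ []
    head-crossing : ∀ T′ → head (T′ ++ x ∷ []) ≡ just s →
                    head (map inj₁ (T′ ++ x ∷ []) ++ map inj₂ (x ∷ U)) ≡ just (inj₁ s)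
    head-crossing [] refl = refl
    head-crossing (_ ∷ _) refl = refl
    disjoint : ∀ {a b} → a ∈ map inj₁ T → b ∈ map inj₂ (x ∷ U) → a ≢ b
    disjoint a∈ b∈ with ∈-map⁻ inj₁ a∈ | ∈-map⁻ inj₂ b∈
    ... | _ , _ , refl | _ , _ , refl = λ ()
    onlyEdge : ∀ {a b} → a ∈ map inj₁ T → b ∈ map inj₂ (x ∷ U) → P a b →
               a ≡ inj₁ x × b ≡ inj₂ x
    onlyEdge a∈ b∈ r with ∈-map⁻ inj₁ a∈ | ∈-map⁻ inj₂ b∈
    onlyEdge a∈ b∈ refl | t , t∈ , refl | _ , w∈ , refl with ∈-++⁻ T′ t∈
    ... | inj₁ t∈T′ = ⊥-elim (All.lookup (All.lookup separated t∈T′) w∈ refl)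
    ... | inj₂ (here refl) = refl , refl

  matchingEdge : ∀ {x} → ThroughBoth (inj₁ x) (inj₂ x) x
  matchingEdge = crossing [] [] refl refl [-] [-] []

  throughComplement : ∀ {a b x} T → Induced (Adj H) T → head T ≡ just a → last T ≡ just x →
                      All (λ t → ¬ ClosedNbhd H b t) T → ThroughBoth (inj₁ a) (inj₁ b) x
  throughComplement {a} {b} {x} (a ∷ T) iT refl lT farFromB =
    map inj₁ (a ∷ T) ++ tailPath ,
    induced-++ P (map-induced iT) (trans (last-map inj₁ (a ∷ T)) (cong (Maybe.map inj₁) lT))
      induced-tailPath refl disjoint onlyEdge ,
    refl , last-++ (map inj₁ (a ∷ T)) (inj₂ x) _ ,
    ∈-++⁺ˡ (∈-map⁺ inj₁ x∈T) , ∈-++⁺ʳ (map inj₁ (a ∷ T)) (here refl)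
    where
    tailPath : List (Fin m ⊎ Fin m)
    tailPath = inj₂ x ∷ inj₂ b ∷ inj₁ b ∷ []
    x∈T : x ∈ a ∷ T
    x∈T = last∈ {xs = a ∷ T} lT
    b≢ : ∀ {t} → t ∈ a ∷ T → t ≢ b
    b≢ t∈ t≡b = All.lookup farFromB t∈ (inj₁ (sym t≡b))
    ¬adj : ∀ {t} → t ∈ a ∷ T → ¬ Adj H t b
    ¬adj t∈ r = All.lookup farFromB t∈ (inj₂ (symm H r))
    induced-tailPath : Induced P tailPath
    induced-tailPath =
      cons (b≢ x∈T , ¬adj x∈T)
        (λ { (here refl) → b≢ x∈T refl ; (there (here ())) ; (there (there ())) })
        (b≢ x∈T ∷ []) (cons refl (λ { (here ()) ; (there ()) }) [] [-])
    disjoint : ∀ {s t} → s ∈ map inj₁ (a ∷ T) → t ∈ tailPath → s ≢ t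
    disjoint s∈ t∈ with ∈-map⁻ inj₁ s∈
    disjoint s∈ (here refl) | _ , _ , refl = λ ()
    disjoint s∈ (there (here refl)) | _ , _ , refl = λ ()
    disjoint s∈ (there (there (here refl))) | _ , t∈ , refl = λ { refl → b≢ t∈ refl }
    onlyEdge : ∀ {s t} → s ∈ map inj₁ (a ∷ T) → t ∈ tailPath → P s t →
               s ≡ inj₁ x × t ≡ inj₂ x
    onlyEdge s∈ t∈ r with ∈-map⁻ inj₁ s∈
    onlyEdge s∈ (here refl) refl | _ , _ , refl = refl , refl
    onlyEdge s∈ (there (here refl)) r | _ , t∈ , refl = ⊥-elim (b≢ t∈ r)
    onlyEdge s∈ (there (there (here refl))) r | _ , t∈ , refl = ⊥-elim (¬adj t∈ r)

module FarPairCase {m : ℕ} (H : Graph m) (connected : Connected H) {u v : Fin m}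
                   (u≢v : u ≢ v) (¬uv : ¬ Adj H u v)
                   (noCommon : ∀ c → ¬ (Adj H u c × Adj H v c)) where
  open Prism H
  open InducedPath (Adj H)
  open Shortcut (Adj H) (irrefl H) (dec H) F._≟_

  farFromU : ∀ pre c suf → Induced (pre ++ c ∷ suf) → head (pre ++ c ∷ suf) ≡ just u →
             ClosedNbhd H v c → All (λ t → ¬ ClosedNbhd H u t) (c ∷ suf)
  farFromU [] c suf _ refl (inj₁ refl) = ⊥-elim (u≢v refl)
  farFromU [] c suf _ refl (inj₂ vu) = ⊥-elim (¬uv (symm H vu))
  farFromU (_ ∷ []) c suf (cons uc _ _ _) refl (inj₁ refl) = ⊥-elim (¬uv uc)
  farFromU (_ ∷ []) c suf (cons uc _ _ _) refl (inj₂ vc) = ⊥-elim (noCommon c (uc , vc))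
  farFromU (_ ∷ _ ∷ pre) c suf (cons _ u∉ ¬uc _) refl _ = All.tabulate λ t∈ →
    λ { (inj₁ refl) → u∉ (there (∈-++⁺ʳ pre t∈))
      ; (inj₂ ut) → All.lookup ¬uc (∈-++⁺ʳ pre t∈) ut }

  covers : ∀ x → Covers (inj₁ u ∷ inj₁ v ∷ []) x
  covers x with walk⇒induced (connected u x)
  ... | Q , iQ , hQ , lQ with splitAtLast (λ c → (v F.≟ c) ⊎-dec dec H v c) Q
  ...   | inj₁ farFromV = _ , _ , here refl , there (here refl) , throughComplement Q iQ hQ lQ farFromV
  ...   | inj₂ (pre , c , suf , refl , inj₁ refl , farFromV) =
          _ , _ , there (here refl) , here refl ,
          throughComplement (c ∷ suf) (induced-drop pre iQ) refl lT (farFromU pre c suf iQ hQ (inj₁ refl))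
    where
    lT : last (c ∷ suf) ≡ just x
    lT = trans (sym (last-++ pre c suf)) lQ
  ...   | inj₂ (pre , c , suf , refl , inj₂ vc , farFromV) =
          _ , _ , there (here refl) , here refl ,
          throughComplement (v ∷ c ∷ suf)
            (cons vc v∉ (All.map (λ ¬N r → ¬N (inj₂ r)) farFromV) (induced-drop pre iQ)) refl lT
            (v-farFromU ∷ farFromU pre c suf iQ hQ (inj₂ vc))
    where
    lT : last (v ∷ c ∷ suf) ≡ just x
    lT = trans (sym (last-++ pre c suf)) lQ
    v∉ : v ∉ c ∷ suf
    v∉ (here refl) = irrefl H vc
    v∉ (there v∈) = All.lookup farFromV v∈ (inj₁ refl)
    v-farFromU : ¬ ClosedNbhd H u v
    v-farFromU (inj₁ u≡v) = u≢v u≡v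
    v-farFromU (inj₂ uv) = ¬uv uv

CommonNeighbours : ∀ {m} → Graph m → Set
CommonNeighbours H = ∀ a b → a ≢ b → ¬ Adj H a b → ∃ λ c → Adj H a c × Adj H b c

CommonNonNeighbours : ∀ {m} → Graph m → Set
CommonNonNeighbours H = ∀ a b → Adj H a b → ∃ λ w → Adj (complement H) a w × Adj (complement H) b w

GoodAt : ∀ {m} → Graph m → Fin m → Fin m → Fin m → Set
GoodAt H u v x = Adj H x v → x ≢ u → ¬ Adj H x u → ∃ λ y → Adj H u y × Adj H x y × y ≢ v

GoodEdge : ∀ {m} → Graph m → Fin m → Fin m → Set
GoodEdge H u v = Adj H u v × ∀ x → GoodAt H u v x

module GoodEdgeCase {m : ℕ} (H : Graph m) (commonNeighbour : CommonNeighbours H)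
                    (commonNonNeighbour : CommonNonNeighbours H) {u v : Fin m} (good : GoodEdge H u v) where
  open Prism H
  open InducedPath using ([-])

  uv : Adj H u v
  uv = proj₁ good

  through : ∀ x → ThroughBoth (inj₁ u) (inj₂ v) x
  through x with x F.≟ u | x F.≟ v
  ... | yes refl | _ with commonNonNeighbour u v uv
  ...   | w , ūw̄ , v̄w̄ =
    crossing [] (w ∷ v ∷ []) refl refl [-]
      (twoEdges-induced (complement H) ūw̄ (symm (complement H) v̄w̄) (λ ūv̄ → proj₂ ūv̄ uv)
        (adj⇒≢ H uv))
      []
  through x | no _ | yes refl =
    crossing (u ∷ []) [] refl refl (edge-induced H uv) [-] ((adj⇒≢ H uv ∷ []) ∷ [])
  through x | no x≢u | no x≢v with dec H u x | dec H x v
  ... | yes ux | no ¬xv =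
    crossing (u ∷ []) (v ∷ []) refl refl (edge-induced H ux) (edge-induced (complement H) (x≢v , ¬xv))
      ((≢-sym x≢u ∷ adj⇒≢ H uv ∷ []) ∷ [])
  ... | yes ux | yes xv with commonNonNeighbour x v xv
  ...   | z , x̄z̄ , v̄z̄ =
    crossing (u ∷ []) (z ∷ v ∷ []) refl refl (edge-induced H ux)
      (twoEdges-induced (complement H) x̄z̄ (symm (complement H) v̄z̄) (λ x̄v̄ → proj₂ x̄v̄ xv) x≢v)
      ((≢-sym x≢u ∷ (λ { refl → proj₂ v̄z̄ (symm H uv) }) ∷ adj⇒≢ H uv ∷ []) ∷ [])
  through x | no x≢u | no x≢v | no ¬ux | yes xv
    with proj₂ good x xv x≢u (λ xu → ¬ux (symm H xu)) | commonNonNeighbour x v xv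
  ... | y , uy , xy , y≢v | z , x̄z̄ , v̄z̄ =
    crossing (u ∷ y ∷ []) (z ∷ v ∷ []) refl refl (twoEdges-induced H uy (symm H xy) ¬ux (≢-sym x≢u))
      (twoEdges-induced (complement H) x̄z̄ (symm (complement H) v̄z̄) (λ x̄v̄ → proj₂ x̄v̄ xv) x≢v)
      ((≢-sym x≢u ∷ (λ { refl → proj₂ v̄z̄ (symm H uv) }) ∷ adj⇒≢ H uv ∷ []) ∷
       (≢-sym (adj⇒≢ H xy) ∷ (λ { refl → proj₂ x̄z̄ xy }) ∷ y≢v ∷ []) ∷ [])
  through x | no x≢u | no x≢v | no ¬ux | no ¬xv with commonNeighbour u x (≢-sym x≢u) ¬ux
  ... | y , uy , xy =
    crossing (u ∷ y ∷ []) (v ∷ []) refl refl (twoEdges-induced H uy (symm H xy) ¬ux (≢-sym x≢u))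
      (edge-induced (complement H) (x≢v , ¬xv))
      ((≢-sym x≢u ∷ adj⇒≢ H uv ∷ []) ∷
       (≢-sym (adj⇒≢ H xy) ∷ (λ { refl → ¬xv xy }) ∷ []) ∷ [])

  covers : ∀ x → Covers (inj₁ u ∷ inj₂ v ∷ []) x
  covers x = inj₁ u , inj₂ v , here refl , there (here refl) , through x

FarPair : ∀ {m} → Graph m → Set
FarPair H = ∃₂ λ u v → u ≢ v × ¬ Adj H u v × (∀ c → ¬ (Adj H u c × Adj H v c))

record BadEdge {m : ℕ} (H : Graph m) (u v : Fin m) : Set where
  field
    {x}        : Fin m
    x-adj-v    : Adj H x v
    x≢u        : x ≢ u
    x-¬adj-u   : ¬ Adj H x u
    onlyCommon : ∀ y → Adj H u y → Adj H x y → y ≡ v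

module _ {m : ℕ} (H : Graph m) where

  farPair? : Dec (FarPair H)
  farPair? = any? λ u → any? λ v →
    ¬? (u F.≟ v) ×-dec ¬? (dec H u v) ×-dec all? λ c → ¬? (dec H u c ×-dec dec H v c)

  ¬farPair⇒commonNeighbours : ¬ FarPair H → CommonNeighbours H
  ¬farPair⇒commonNeighbours ¬far a b a≢b ¬ab with any? (λ c → dec H a c ×-dec dec H b c)
  ... | yes common = common
  ... | no ¬common = ⊥-elim (¬far (a , b , a≢b , ¬ab , λ c ac×bc → ¬common (c , ac×bc)))

  goodAt? : ∀ u v x → Dec (GoodAt H u v x)
  goodAt? u v x = dec H x v →-dec ¬? (x F.≟ u) →-dec ¬? (dec H x u) →-dec
                  any? (λ y → dec H u y ×-dec dec H x y ×-dec ¬? (y F.≟ v))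

  goodEdge? : Dec (∃₂ (GoodEdge H))
  goodEdge? = any? λ u → any? λ v → dec H u v ×-dec all? (goodAt? u v)

  ¬goodEdge⇒badEdge : ¬ ∃₂ (GoodEdge H) → ∀ u v → Adj H u v → BadEdge H u v
  ¬goodEdge⇒badEdge ¬good u v uv with ¬∀⟶∃¬ m _ (goodAt? u v) (λ good → ¬good (u , v , uv , good))
  ... | x , ¬goodAt with dec H x v | x F.≟ u | dec H x u
  ... | no ¬xv | _       | _      = ⊥-elim (¬goodAt λ xv → ⊥-elim (¬xv xv))
  ... | yes _  | yes x≡u | _      = ⊥-elim (¬goodAt λ _ x≢u → ⊥-elim (x≢u x≡u))
  ... | yes _  | no _    | yes xu = ⊥-elim (¬goodAt λ _ _ ¬xu → ⊥-elim (¬xu xu))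
  ... | yes xv | no x≢u  | no ¬xu =
    record { x-adj-v = xv ; x≢u = x≢u ; x-¬adj-u = ¬xu ; onlyCommon = onlyCommon }
    where
    onlyCommon : ∀ y → Adj H u y → Adj H x y → y ≡ v
    onlyCommon y uy xy with y F.≟ v
    ... | yes y≡v = y≡v
    ... | no y≢v = ⊥-elim (¬goodAt λ _ _ _ → y , uy , xy , y≢v)

  commonNeighbours-complement : CommonNeighbours (complement H) → CommonNonNeighbours H
  commonNeighbours-complement common a b ab = common a b (adj⇒≢ H ab) (λ āb̄ → proj₂ āb̄ ab)

  commonNeighbours⇒commonNonNeighbours-complement : CommonNeighbours H → CommonNonNeighbours (complement H)
  commonNeighbours⇒commonNonNeighbours-complement common a b (a≢b , ¬ab) with common a b a≢b ¬ab
  ... | w , aw , bw =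
    w , (adj⇒≢ H aw , λ āw̄ → proj₂ āw̄ aw) , (adj⇒≢ H bw , λ b̄w̄ → proj₂ b̄w̄ bw)

next : Fin 5 → Fin 5
next 0F = 1F
next 1F = 2F
next 2F = 3F
next 3F = 4F
next 4F = 0F

Consecutive : Fin 5 → Fin 5 → Set
Consecutive i j = j ≡ next i ⊎ i ≡ next j

record IsPentagon {m : ℕ} (G : Graph m) (c : Fin 5 → Fin m) : Set where
  field
    edge    : ∀ i → Adj G (c i) (c (next i))
    nonEdge : ∀ i → ¬ Adj G (c i) (c (next (next i)))

private
  consecutive? : ∀ i j → Dec (Consecutive i j)
  consecutive? i j = (j F.≟ next i) ⊎-dec (i F.≟ next j)

  relative : ∀ i j → Consecutive i j ⊎
                     (¬ Consecutive i j × (j ≡ i ⊎ j ≡ next (next i) ⊎ i ≡ next (next j)))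
  relative = toWitness {a? = all? λ i → all? λ j →
    consecutive? i j ⊎-dec
    (¬? (consecutive? i j) ×-dec ((j F.≟ i) ⊎-dec (j F.≟ next (next i)) ⊎-dec (i F.≟ next (next j))))} _

  consecutive-injective : ∀ i j → (∀ k → Consecutive i k → Consecutive j k) → i ≡ j
  consecutive-injective = toWitness {a? = all? λ i → all? λ j →
    all? (λ k → consecutive? i k →-dec consecutive? j k) →-dec (i F.≟ j)} _

module _ {m : ℕ} {G : Graph m} {c : Fin 5 → Fin m} (pentagon : IsPentagon G c) where
  open IsPentagon pentagon

  pentagon-adj⇔consecutive : ∀ i j → Adj G (c i) (c j) ⇔ Consecutive i j
  pentagon-adj⇔consecutive i j with relative i j
  ... | inj₁ i~j = mk⇔ (λ _ → i~j) λ { (inj₁ refl) → edge i ; (inj₂ refl) → symm G (edge j) }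
  ... | inj₂ (¬i~j , far) = mk⇔ (λ cij → ⊥-elim (nonAdjacent far cij)) (λ i~j → ⊥-elim (¬i~j i~j))
    where
    nonAdjacent : j ≡ i ⊎ j ≡ next (next i) ⊎ i ≡ next (next j) → ¬ Adj G (c i) (c j)
    nonAdjacent (inj₁ refl) = irrefl G
    nonAdjacent (inj₂ (inj₁ refl)) = nonEdge i
    nonAdjacent (inj₂ (inj₂ refl)) cij = nonEdge j (symm G cij)

  pentagon-injective : ∀ {i j} → c i ≡ c j → i ≡ j
  pentagon-injective {i} {j} ci≡cj = consecutive-injective i j λ k i~k →
    Equivalence.to (pentagon-adj⇔consecutive j k)
      (subst (λ a → Adj G a (c k)) ci≡cj (Equivalence.from (pentagon-adj⇔consecutive i k) i~k))

C5-pentagon : IsPentagon C5 (λ i → i)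
C5-pentagon = record
  { edge = toWitness {a? = all? λ i → dec C5 i (next i)} _
  ; nonEdge = toWitness {a? = all? λ i → ¬? (dec C5 i (next (next i)))} _ }

pentagon⇒≅C5 : ∀ {m} {G : Graph m} {c : Fin 5 → Fin m} →
               IsPentagon G c → (∀ w → ∃ λ i → c i ≡ w) → Isomorphic G C5
pentagon⇒≅C5 {G = G} {c} pentagon onto =
  mk↔ₛ′ label c (λ i → pentagon-injective pentagon (proj₂ (onto (c i)))) (λ w → proj₂ (onto w)) ,
  adj⇔
  where
  label : _ → Fin 5
  label w = proj₁ (onto w)
  adj⇔ : ∀ a b → Adj G a b ⇔ Adj C5 (label a) (label b)
  adj⇔ a b with onto a | onto b
  ... | i , refl | j , refl =
    ⇔.trans (pentagon-adj⇔consecutive pentagon i j) (⇔.sym (pentagon-adj⇔consecutive C5-pentagon i j))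

module AllEdgesBad {m : ℕ} (G : Graph m) (commonNeighbour : CommonNeighbours G)
                   (badG : ∀ u v → Adj G u v → BadEdge G u v)
                   (badḠ : ∀ u v → Adj (complement G) u v → BadEdge (complement G) u v)
                   {u v : Fin m} (uv : Adj G u v) where

  adj-by-contradiction : ∀ {a b} → ¬ ¬ Adj G a b → Adj G a b
  adj-by-contradiction = decidable-stable (dec G _ _)

  -- The bad Ḡ-edge aq has a witness p′ adjacent to a. If p′ were not adjacent to p, then p would be a
  -- second common Ḡ-neighbour of a and p′; so p′ ∈ N(a) ∩ N(p) = {b}, and q is the only common
  -- Ḡ-neighbour of a and b.
  uniqueCommonNonNeighbour : ∀ {a b p q} → a ≢ q → ¬ Adj G a q → p ≢ a → ¬ Adj G p a → p ≢ q →
                             (∀ y → Adj G a y → Adj G p y → y ≡ b) →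
                             ∀ t → a ≢ t → ¬ Adj G a t → b ≢ t → ¬ Adj G b t → t ≡ q
  uniqueCommonNonNeighbour {a} {b} {p} {q} a≢q ¬aq p≢a ¬pa p≢q onlyCommonAP t a≢t ¬at b≢t ¬bt
    with badḠ a q (a≢q , ¬aq)
  ... | record { x = p′ ; x≢u = p′≢a ; x-¬adj-u = ¬Ḡp′a ; onlyCommon = onlyCommonḠ }
    with dec G p′ p
  ... | no ¬p′p =
    ⊥-elim (p≢q (onlyCommonḠ p (≢-sym p≢a , λ ap → ¬pa (symm G ap)) (p′≢p , ¬p′p)))
    where
    p′≢p : p′ ≢ p
    p′≢p refl = ¬pa (adj-by-contradiction λ ¬pa → ¬Ḡp′a (p′≢a , ¬pa))
  ... | yes p′p
    with onlyCommonAP p′ (symm G (adj-by-contradiction λ ¬p′a → ¬Ḡp′a (p′≢a , ¬p′a)))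
                         (symm G p′p)
  ...   | refl = onlyCommonḠ t (a≢t , ¬at) (b≢t , ¬bt)

  open BadEdge (badG u v uv) renaming
    (x-adj-v to xv; x-¬adj-u to ¬xu; onlyCommon to onlyCommonUX)
  open BadEdge (badG v u (symm G uv)) renaming
    (x to y; x-adj-v to yu; x≢u to y≢v; x-¬adj-u to ¬yv; onlyCommon to onlyCommonVY)

  ¬yx : ¬ Adj G y x
  ¬yx yx = y≢v (onlyCommonUX y (symm G yu) (symm G yx))

  y≢x : y ≢ x
  y≢x y≡x = ¬xu (subst (λ a → Adj G a u) y≡x yu)

  z : Fin m
  z = proj₁ (commonNeighbour y x y≢x ¬yx)

  yz : Adj G y z
  yz = proj₁ (proj₂ (commonNeighbour y x y≢x ¬yx))

  xz : Adj G x z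
  xz = proj₂ (proj₂ (commonNeighbour y x y≢x ¬yx))

  ¬zu : ¬ Adj G z u
  ¬zu zu = ¬yv (subst (Adj G y) (onlyCommonUX z (symm G zu) xz) yz)

  ¬zv : ¬ Adj G z v
  ¬zv zv = ¬xu (subst (Adj G x) (onlyCommonVY z (symm G zv) yz) xz)

  cycle : Fin 5 → Fin m
  cycle 0F = u
  cycle 1F = v
  cycle 2F = x
  cycle 3F = z
  cycle 4F = y

  pentagon : IsPentagon G cycle
  pentagon = record { edge = edge ; nonEdge = nonEdge }
    where
    edge : ∀ i → Adj G (cycle i) (cycle (next i))
    edge 0F = uv
    edge 1F = symm G xv
    edge 2F = xz
    edge 3F = symm G yz
    edge 4F = yu
    nonEdge : ∀ i → ¬ Adj G (cycle i) (cycle (next (next i)))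
    nonEdge 0F ux = ¬xu (symm G ux)
    nonEdge 1F vz = ¬zv (symm G vz)
    nonEdge 2F xy = ¬yx (symm G xy)
    nonEdge 3F = ¬zu
    nonEdge 4F = ¬yv

  commonNonNeighbourUV⇒z : ∀ t → u ≢ t → ¬ Adj G u t → v ≢ t → ¬ Adj G v t → t ≡ z
  commonNonNeighbourUV⇒z =
    uniqueCommonNonNeighbour (λ u≡z → ¬zv (subst (λ a → Adj G a v) u≡z uv)) (λ uz → ¬zu (symm G uz))
                              x≢u ¬xu (adj⇒≢ G xz) onlyCommonUX

  commonNonNeighbourYU⇒x : ∀ t → y ≢ t → ¬ Adj G y t → u ≢ t → ¬ Adj G u t → t ≡ x
  commonNonNeighbourYU⇒x = uniqueCommonNonNeighbour y≢x ¬yx (≢-sym y≢v) (λ vy → ¬yv (symm G vy))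
                              (adj⇒≢ G xv ∘ sym) (λ w yw vw → onlyCommonVY w vw yw)

  -- w is adjacent to u, for otherwise it would be z, x or u; hence w is not adjacent to x. The bad
  -- Ḡ-edge xw then yields a common neighbour p of u and x that is adjacent to y, but p can only be v.
  noOther : ∀ w → (∀ i → cycle i ≢ w) → ⊥
  noOther w ≢w = ¬yv (subst (Adj G y) (onlyCommonUX p (symm G pu) (symm G px)) (symm G py))
    where
    wu : Adj G w u
    wu = adj-by-contradiction λ ¬wu →
      let ¬uw = λ uw → ¬wu (symm G uw)
          vw = adj-by-contradiction λ ¬vw →
                 ≢w 3F (sym (commonNonNeighbourUV⇒z w (≢w 0F) ¬uw (≢w 1F) ¬vw))
          yw = adj-by-contradiction λ ¬yw →
                 ≢w 2F (sym (commonNonNeighbourYU⇒x w (≢w 4F) ¬yw (≢w 0F) ¬uw))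
      in ≢w 0F (sym (onlyCommonVY w vw yw))
    ¬xw : ¬ Adj G x w
    ¬xw xw = ≢w 1F (sym (onlyCommonUX w (symm G wu) xw))
    open BadEdge (badḠ x w (≢w 2F , ¬xw)) renaming
      (x to p; x≢u to p≢x; x-¬adj-u to ¬Ḡpx; onlyCommon to onlyCommonḠ)
    px : Adj G p x
    px = adj-by-contradiction λ ¬px → ¬Ḡpx (p≢x , ¬px)
    py : Adj G p y
    py = adj-by-contradiction λ ¬py →
      ≢w 4F (onlyCommonḠ y (≢-sym y≢x , λ xy → ¬yx (symm G xy))
                           ((λ p≡y → ¬yx (subst (λ a → Adj G a x) p≡y px)) , ¬py))
    pu : Adj G p u
    pu = adj-by-contradiction λ ¬pu →
      ≢w 0F (onlyCommonḠ u (x≢u , ¬xu)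
                           ((λ p≡u → ¬xu (symm G (subst (λ a → Adj G a x) p≡u px))) , ¬pu))

  onto : ∀ w → ∃ λ i → cycle i ≡ w
  onto w with any? (λ i → cycle i F.≟ w)
  ... | yes found = found
  ... | no ¬found = ⊥-elim (noOther w (λ i ci≡w → ¬found (i , ci≡w)))

  isomorphic : Isomorphic G C5
  isomorphic = pentagon⇒≅C5 pentagon onto

module Enumeration {V : Set} (R : V → V → Set) (R? : ∀ a b → Dec (R a b)) (_≟_ : DecidableEquality V)
                   (vertices : List V) (∈-vertices : ∀ x → x ∈ vertices) where
  open InducedPath R
  open DecMembership _≟_ using (_∈?_)

  InducedList : Set
  InducedList = Σ (List V) Induced

  extend : V → InducedList → List InducedList
  extend a ([] , _) = []
  extend a (b ∷ q , ip) with R? a b ×-dec ¬? (a ∈? b ∷ q) ×-dec All.all? (λ c → ¬? (R? a c)) q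
  ... | yes (ab , a∉ , ¬ac) = (a ∷ b ∷ q , cons ab a∉ ¬ac ip) ∷ []
  ... | no _ = []

  inducedOfSize : ℕ → List InducedList
  inducedOfSize zero = []
  inducedOfSize (suc zero) = map (λ a → a ∷ [] , [-]) vertices
  inducedOfSize (suc (suc k)) =
    concatMap (λ P → concatMap (λ a → extend a P) vertices) (inducedOfSize (suc k))

  inducedUpTo : ℕ → List InducedList
  inducedUpTo zero = []
  inducedUpTo (suc k) = inducedOfSize (suc k) ++ inducedUpTo k

  inducedOfSize-complete : ∀ {b q} → Induced (b ∷ q) →
                           Any (λ P → proj₁ P ≡ b ∷ q) (inducedOfSize (length (b ∷ q)))
  inducedOfSize-complete {b} [-] = Anyₚ.map⁺ (Any.map (λ { refl → refl }) (∈-vertices b))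
  inducedOfSize-complete {a} (cons {b = b} {p = q} ab a∉ ¬ac ip) =
    Anyₚ.concatMap⁺ _ (Any.map
      (λ {P} e → Anyₚ.concatMap⁺ _ (Any.map (λ { refl → extended P e }) (∈-vertices a)))
      (inducedOfSize-complete ip))
    where
    extended : ∀ P → proj₁ P ≡ b ∷ q → Any (λ P′ → proj₁ P′ ≡ a ∷ b ∷ q) (extend a P)
    extended (_ , ip′) refl with R? a b ×-dec ¬? (a ∈? b ∷ q) ×-dec All.all? (λ c → ¬? (R? a c)) q
    ... | yes _ = here refl
    ... | no fails = ⊥-elim (fails (ab , a∉ , ¬ac))

  inducedOfSize-vanishes : ∀ N → inducedOfSize (suc N) ≡ [] → ∀ k → N < k → inducedOfSize k ≡ []
  inducedOfSize-vanishes N vanishes (suc k) N<1+k with m≤n⇒m<n∨m≡n (≤-pred N<1+k)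
  ... | inj₂ refl = vanishes
  inducedOfSize-vanishes N vanishes (suc zero) _ | inj₁ ()
  inducedOfSize-vanishes N vanishes (suc (suc k)) _ | inj₁ N<1+k =
    cong (concatMap _) (inducedOfSize-vanishes N vanishes (suc k) N<1+k)

  inducedUpTo⁺ : ∀ {Q : InducedList → Set} {L} N → L ≤ N →
                 Any Q (inducedOfSize L) → Any Q (inducedUpTo N)
  inducedUpTo⁺ zero z≤n ()
  inducedUpTo⁺ (suc N) L≤1+N found with m≤n⇒m<n∨m≡n L≤1+N
  ... | inj₂ refl = Anyₚ.++⁺ˡ found
  ... | inj₁ (s≤s L≤N) = Anyₚ.++⁺ʳ (inducedOfSize (suc N)) (inducedUpTo⁺ N L≤N found)

  Joins : V → V → V → InducedList → Set
  Joins a b x P = head (proj₁ P) ≡ just a × last (proj₁ P) ≡ just b × x ∈ proj₁ P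

  joins? : ∀ a b x P → Dec (Joins a b x P)
  joins? a b x P = Maybeₚ.≡-dec _≟_ _ _ ×-dec Maybeₚ.≡-dec _≟_ _ _ ×-dec (x ∈? proj₁ P)

  CoveredBy : List InducedList → List V → Set
  CoveredBy Ps S = All (λ x → Any (λ a → Any (λ b → Any (Joins a b x) Ps) S) S) vertices

  coveredBy? : ∀ Ps S → Dec (CoveredBy Ps S)
  coveredBy? Ps S =
    All.all? (λ x → Any.any? (λ a → Any.any? (λ b → Any.any? (joins? a b x) Ps) S) S) vertices

  module _ (N : ℕ) (bounded : inducedOfSize (suc N) ≡ []) where

    interval⇔joined : ∀ {a b x} → InInterval R a b x ⇔ Any (Joins a b x) (inducedUpTo N)
    interval⇔joined = mk⇔ joined interval
      where
      joined : ∀ {a b x} → InInterval R a b x → Any (Joins a b x) (inducedUpTo N)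
      joined (c ∷ q , mp , hp , lp , x∈) with inducedOfSize-complete (monophonic⇒induced (c ∷ q) mp)
      ... | found with suc (length q) ≤? N
      ...   | yes size≤N = inducedUpTo⁺ N size≤N (Any.map (λ { {_ , _} refl → hp , lp , x∈ }) found)
      ...   | no size≰N =
        ⊥-elim (¬Any[] (subst (Any _) (inducedOfSize-vanishes N bounded _ (≰⇒> size≰N)) found))
      interval : ∀ {a b x} → Any (Joins a b x) (inducedUpTo N) → InInterval R a b x
      interval found with Any.satisfied found
      ... | (p , ip) , hp , lp , x∈ = induced⇒interval ip hp lp x∈

    coveredBy⇔monophonicSet : ∀ {S} → CoveredBy (inducedUpTo N) S ⇔ IsMonophonicSet R S
    coveredBy⇔monophonicSet {S} = mk⇔ monophonic covered
      where
      monophonic : CoveredBy (inducedUpTo N) S → IsMonophonicSet R S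
      monophonic coveredS x with find (All.lookup coveredS (∈-vertices x))
      ... | a , a∈ , viaA with find viaA
      ...   | b , b∈ , joined = a , b , a∈ , b∈ , Equivalence.from interval⇔joined joined
      covered : IsMonophonicSet R S → CoveredBy (inducedUpTo N) S
      covered monoS = All.tabulate λ {x} _ → let a , b , a∈ , b∈ , J = monoS x in
        lose a∈ (lose b∈ (Equivalence.to interval⇔joined J))

prismVertices : ∀ m → List (Fin m ⊎ Fin m)
prismVertices m = map inj₁ (allFin m) ++ map inj₂ (allFin m)

∈-prismVertices : ∀ {m} x → x ∈ prismVertices m
∈-prismVertices (inj₁ a) = ∈-++⁺ˡ (∈-map⁺ inj₁ (∈-allFin a))
∈-prismVertices {m} (inj₂ a) = ∈-++⁺ʳ (map inj₁ (allFin m)) (∈-map⁺ inj₂ (∈-allFin a))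

prismAdj? : ∀ {m} (H : Graph m) a b → Dec (PrismAdj H a b)
prismAdj? H (inj₁ a) (inj₁ b) = dec H a b
prismAdj? H (inj₁ a) (inj₂ b) = a F.≟ b
prismAdj? H (inj₂ a) (inj₁ b) = a F.≟ b
prismAdj? H (inj₂ a) (inj₂ b) = dec (complement H) a b

module C5Prism where
  open Enumeration (PrismAdj C5) (prismAdj? C5) (Sumₚ.≡-dec F._≟_ F._≟_) (prismVertices 5) ∈-prismVertices

  noInducedPathOfSize6 : inducedOfSize 6 ≡ []
  noInducedPathOfSize6 = refl

  monophonic⇔ : ∀ {S} → CoveredBy (inducedUpTo 5) S ⇔ IsMonophonicSet (PrismAdj C5) S
  monophonic⇔ = coveredBy⇔monophonicSet 5 noInducedPathOfSize6

  -- The enumerated paths are an argument so that the decision below evaluates them only once.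
  NoPairCoveredBy : List InducedList → Set
  NoPairCoveredBy Ps =
    All (λ a → All (λ b → ¬ CoveredBy Ps (a ∷ b ∷ [])) (prismVertices 5)) (prismVertices 5)

  noPairCoveredBy? : ∀ Ps → Dec (NoPairCoveredBy Ps)
  noPairCoveredBy? Ps =
    All.all? (λ a → All.all? (λ b → ¬? (coveredBy? Ps (a ∷ b ∷ []))) (prismVertices 5)) (prismVertices 5)

  noPairCovered : NoPairCoveredBy (inducedUpTo 5)
  noPairCovered = toWitness {a? = noPairCoveredBy? (inducedUpTo 5)} _

  triple : List (Fin 5 ⊎ Fin 5)
  triple = inj₁ 0F ∷ inj₁ 1F ∷ inj₁ 3F ∷ []

  triple-monophonic : IsMonophonicSet (PrismAdj C5) triple
  triple-monophonic = Equivalence.to monophonic⇔ (toWitness {a? = coveredBy? (inducedUpTo 5) triple} _)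

  monophonicNumber : MonophonicNumberIs (PrismAdj C5) 3
  monophonicNumber = (triple , unique , refl , triple-monophonic) , three≤
    where
    unique : Unique triple
    unique = ((λ ()) ∷ (λ ()) ∷ []) ∷ ((λ ()) ∷ []) ∷ [] ∷ []
    three≤ : ∀ S → Unique S → IsMonophonicSet (PrismAdj C5) S → 3 ≤ length S
    three≤ (_ ∷ _ ∷ _ ∷ _) _ _ = s≤s (s≤s (s≤s z≤n))
    three≤ (a ∷ b ∷ []) _ monoS =
      ⊥-elim (All.lookup (All.lookup noPairCovered (∈-prismVertices a)) (∈-prismVertices b)
                (Equivalence.from monophonic⇔ monoS))
    three≤ (a ∷ []) _ monoS with two≤monophonicSet (PrismAdj C5) {inj₁ 0F} {inj₂ 0F} (λ ()) _ monoS
    ... | s≤s ()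
    three≤ [] _ monoS with two≤monophonicSet (PrismAdj C5) {inj₁ 0F} {inj₂ 0F} (λ ()) _ monoS
    ... | ()

PrismPair : ∀ {m} → Graph m → Set
PrismPair H = ∃₂ λ a b → a ≢ b × IsMonophonicSet (PrismAdj H) (a ∷ b ∷ [])

module _ {m : ℕ} (H : Graph m) where

  prismPair-complement : PrismPair (complement H) → PrismPair H
  prismPair-complement (a , b , a≢b , monoS) =
    swap a , swap b , a≢b ∘ _≅_.to-injective back , map-monophonicSet back monoS
    where
    back : PrismAdj (complement H) ≅ PrismAdj H
    back = ≅-sym (prism-complement H)

  farPair⇒prismPair : Connected H → FarPair H → PrismPair H
  farPair⇒prismPair connected (u , v , u≢v , ¬uv , noCommon) =
    inj₁ u , inj₁ v , (λ { refl → u≢v refl }) ,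
    Prism.covers⇒monophonicSet H (FarPairCase.covers H connected u≢v ¬uv noCommon)

  goodEdge⇒prismPair : CommonNeighbours H → CommonNonNeighbours H → ∃₂ (GoodEdge H) → PrismPair H
  goodEdge⇒prismPair common commonNon (u , v , good) =
    inj₁ u , inj₂ v , (λ ()) , Prism.covers⇒monophonicSet H (GoodEdgeCase.covers H common commonNon good)

someEdge : ∀ {n} (G : Graph (suc (suc n))) → Connected G → ∃₂ (Adj G)
someEdge G connected with connected 0F 1F
... | uv ◅ _ = _ , _ , uv

diameterTwo⇒prismPair : ∀ {n} (G : Graph (suc (suc n))) → Connected G →
                        CommonNeighbours G → CommonNeighbours (complement G) →
                        ¬ Isomorphic G C5 → PrismPair G
diameterTwo⇒prismPair G connected common commonḠ ¬C5 with goodEdge? G | goodEdge? (complement G)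
... | yes good | _ = goodEdge⇒prismPair G common (commonNeighbours-complement G commonḠ) good
... | no _ | yes goodḠ = prismPair-complement G
  (goodEdge⇒prismPair (complement G) commonḠ
    (commonNeighbours⇒commonNonNeighbours-complement G common) goodḠ)
... | no ¬good | no ¬goodḠ =
  ⊥-elim (¬C5 (AllEdgesBad.isomorphic G common (¬goodEdge⇒badEdge G ¬good)
                 (¬goodEdge⇒badEdge (complement G) ¬goodḠ) (proj₂ (proj₂ (someEdge G connected)))))

prismPair : ∀ {n} (G : Graph (suc n)) → Connected G → Connected (complement G) →
            ¬ Isomorphic G C5 → PrismPair G
prismPair {zero} G _ _ _ = inj₁ 0F , inj₂ 0F , (λ ()) , Prism.covers⇒monophonicSet G λ { 0F →
  inj₁ 0F , inj₂ 0F , here refl , there (here refl) , Prism.matchingEdge G }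
prismPair {suc n} G connected connectedḠ ¬C5 with farPair? G | farPair? (complement G)
... | yes far | _ = farPair⇒prismPair G connected far
... | no _ | yes farḠ = prismPair-complement G (farPair⇒prismPair (complement G) connectedḠ farḠ)
... | no ¬far | no ¬farḠ = diameterTwo⇒prismPair G connected
  (¬farPair⇒commonNeighbours G ¬far) (¬farPair⇒commonNeighbours (complement G) ¬farḠ) ¬C5

theorem4p6 : ∀ {n : ℕ} (G : Graph (suc n)) → Connected G → Connected (complement G) →
    (Isomorphic G C5 → MonophonicNumberIs (PrismAdj G) 3) ×
    (¬ Isomorphic G C5 → MonophonicNumberIs (PrismAdj G) 2)
theorem4p6 G connected connectedḠ =
  (λ G≅C5 → monophonicNumber-≅ (≅-sym (prism-≅ G C5 (isomorphic⇒≅ G C5 G≅C5)))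
                               C5Prism.monophonicNumber) ,
  (λ ¬C5 → let a , b , a≢b , monoS = prismPair G connected connectedḠ ¬C5 in
           monophonicNumber≡2 (PrismAdj G) {inj₁ 0F} {inj₂ 0F} (λ ()) a≢b monoS)
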